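{- Let $Y,Z$ be sets satisfying \[ \{\emptyset\}\otimes(\{\emptyset\}\cup Y)=Z \qquad\text{and}\qquad Y\subsetneq Z. \] Then $\mathrm{rk}(Z)<\omega$ and $|Z\setminus Y|=1$.
   Context: We work in ZFC with the Axiom of Regularity; $\mathrm{rk}$ denotes von Neumann rank. For sets $A,B$, the unordered Cartesian product is $A\otimes B := \{\{a,b\}\mid a\in A,\ b\in B\}$. -}

module Defs where

-- Sets are modelled by Aczel's iterative sets (well-founded trees with
-- extensional equality).  Well-foundedness (Regularity) is built in.
-- Classical logic is supplied as an explicit hypothesis in the theorem.

open import Data.Empty using (⊥; ⊥-elim)
open import Data.Unit using (⊤; tt)
open import Data.Bool using (Bool; true; false; if_then_else_)
open import Data.Sum using (_⊎_; inj₁; inj₂; [_,_])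
open import Data.Product using (Σ; _×_; _,_; proj₁; proj₂)
open import Data.Nat using (ℕ; zero; suc)
open import Relation.Nullary using (¬_)

data V : Set₁ where
  sup : (A : Set) → (A → V) → V

_≐_ : V → V → Set
sup A f ≐ sup B g =
  ((a : A) → Σ B λ b → f a ≐ g b) × ((b : B) → Σ A λ a → f a ≐ g b)

_∈_ : V → V → Set
x ∈ sup A f = Σ A λ a → x ≐ f a

_⊆_ : V → V → Set₁
x ⊆ y = (z : V) → z ∈ x → z ∈ y

_⊊_ : V → V → Set₁
x ⊊ y = x ⊆ y × ¬ (x ≐ y)

∅ : V
∅ = sup ⊥ ⊥-elim

⟦_⟧ : V → V
⟦ x ⟧ = sup ⊤ (λ _ → x)

pair : V → V → V
pair x y = sup Bool (λ b → if b then x else y)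

_∪_ : V → V → V
sup A f ∪ sup B g = sup (A ⊎ B) [ f , g ]

_⊗_ : V → V → V
sup A f ⊗ sup B g = sup (A × B) (λ p → pair (f (proj₁ p)) (g (proj₂ p)))

_∖_ : V → V → V
sup A f ∖ y = sup (Σ A λ a → ¬ (f a ∈ y)) (λ p → f (proj₁ p))

-- RankBelow n x  ⇔  x ∈ V_n  ⇔  rk(x) < n
RankBelow : ℕ → V → Set
RankBelow zero    _         = ⊥
RankBelow (suc n) (sup A f) = (a : A) → RankBelow n (f a)

RankFinite : V → Set
RankFinite x = Σ ℕ λ n → RankBelow n x

CardOne : V → Set₁
CardOne X = Σ V λ z → X ≐ ⟦ z ⟧

module Submission where

-- Put numeral 0 = ∅ and numeral (k+1) = {∅, numeral k}.  Every member of Z has the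
-- form {∅, ∅} = numeral 1 or {∅, y} with y ∈ Y ⊆ Z, so by ∈-induction every member
-- of Z is some numeral (k+1), and Y contains numeral 1, …, numeral k.  A member
-- numeral (m+1) of Z ∖ Y therefore caps the index of every member of Z at m, whence
-- Z = {numeral 1, …, numeral (m+1)} has finite rank, and Y ∋ numeral 1, …, numeral m
-- leaves numeral (m+1) as the only member of Z ∖ Y.

open import Defs
open import Axiom.ExcludedMiddle using (ExcludedMiddle)
open import Agda.Primitive using (lzero)
open import Data.Product using (Σ; _×_; _,_; proj₁; proj₂)
open import Data.Empty using (⊥-elim)
open import Data.Unit using (tt)
open import Data.Bool using (true; false)
open import Data.Sum using (_⊎_; inj₁; inj₂)
open import Data.Nat using (ℕ; zero; suc; _≤_; _<_; s≤s; _<?_)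
open import Data.Nat.Properties using (≮⇒≥; m≤n⇒m<n∨m≡n; m<1+n⇒m<n∨m≡n)
open import Relation.Nullary using (¬_; yes; no)
open import Relation.Binary.PropositionalEquality using (refl)

≐-refl : ∀ x → x ≐ x
≐-refl (sup A f) = (λ a → a , ≐-refl (f a)) , (λ a → a , ≐-refl (f a))

≐-sym : ∀ {x y} → x ≐ y → y ≐ x
≐-sym {sup A f} {sup B g} (p , q) =
  (λ b → proj₁ (q b) , ≐-sym (proj₂ (q b))) ,
  (λ a → proj₁ (p a) , ≐-sym (proj₂ (p a)))

≐-trans : ∀ {x y z} → x ≐ y → y ≐ z → x ≐ z
≐-trans {sup A f} {sup B g} {sup C h} (p , q) (p' , q') =
  (λ a → proj₁ (p' (proj₁ (p a))) , ≐-trans (proj₂ (p a)) (proj₂ (p' (proj₁ (p a))))) ,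
  (λ c → proj₁ (q (proj₁ (q' c))) , ≐-trans (proj₂ (q (proj₁ (q' c)))) (proj₂ (q' c)))

∈-respˡ-≐ : ∀ {x y z} → x ≐ y → x ∈ z → y ∈ z
∈-respˡ-≐ {z = sup C h} x≐y (c , x≐hc) = c , ≐-trans (≐-sym x≐y) x≐hc

∈-respʳ-≐ : ∀ {x y z} → y ≐ z → x ∈ y → x ∈ z
∈-respʳ-≐ {y = sup B g} {sup C h} (p , _) (b , x≐gb) =
  proj₁ (p b) , ≐-trans x≐gb (proj₂ (p b))

≐-ext : ∀ {x y} → (∀ z → z ∈ x → z ∈ y) → (∀ z → z ∈ y → z ∈ x) → x ≐ y
≐-ext {sup A f} {sup B g} x⊆y y⊆x =
  (λ a → x⊆y (f a) (a , ≐-refl (f a))) ,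
  (λ b → let (a , gb≐fa) = y⊆x (g b) (b , ≐-refl (g b)) in a , ≐-sym gb≐fa)

≐-singleton : ∀ {x y} → (∀ z → z ∈ x → z ≐ y) → y ∈ x → x ≐ ⟦ y ⟧
≐-singleton {y = y} all≐y y∈x =
  ≐-ext (λ z z∈x → tt , all≐y z z∈x) (λ { z (tt , z≐y) → ∈-respˡ-≐ (≐-sym z≐y) y∈x })

pair-cong : ∀ {x x′ y y′} → x ≐ x′ → y ≐ y′ → pair x y ≐ pair x′ y′
pair-cong x≐x′ y≐y′ =
  (λ { true → true , x≐x′ ; false → false , y≐y′ }) ,
  (λ { true → true , x≐x′ ; false → false , y≐y′ })

∈-pairʳ : ∀ x y → y ∈ pair x y
∈-pairʳ x y = false , ≐-refl y

∈-⟦⟧ : ∀ {x y} → x ∈ ⟦ y ⟧ → x ≐ y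
∈-⟦⟧ (tt , x≐y) = x≐y

∈-∪ : ∀ {x y z} → x ∈ (y ∪ z) → x ∈ y ⊎ x ∈ z
∈-∪ {y = sup A f} {sup B g} (inj₁ a , x≐fa) = inj₁ (a , x≐fa)
∈-∪ {y = sup A f} {sup B g} (inj₂ b , x≐gb) = inj₂ (b , x≐gb)

∈-⊗ : ∀ {x y z} → x ∈ (y ⊗ z) →
      Σ V λ a → Σ V λ b → a ∈ y × b ∈ z × x ≐ pair a b
∈-⊗ {y = sup A f} {sup B g} ((a , b) , x≐pair) =
  f a , g b , (a , ≐-refl (f a)) , (b , ≐-refl (g b)) , x≐pair

∈-∖ : ∀ {x y z} → x ∈ (y ∖ z) → x ∈ y × ¬ (x ∈ z)
∈-∖ {y = sup A f} ((a , fa∉z) , x≐fa) = (a , x≐fa) , λ x∈z → fa∉z (∈-respˡ-≐ x≐fa x∈z)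

∖-∈ : ∀ {x y z} → x ∈ y → ¬ (x ∈ z) → x ∈ (y ∖ z)
∖-∈ {y = sup A f} (a , x≐fa) x∉z = (a , λ fa∈z → x∉z (∈-respˡ-≐ (≐-sym x≐fa) fa∈z)) , x≐fa

⊊-witness : ExcludedMiddle lzero → ∀ {x y} → x ⊊ y → Σ V λ z → z ∈ y × ¬ (z ∈ x)
⊊-witness em {x} {sup C g} (x⊆y , x≉y) with em {Σ C λ c → ¬ (g c ∈ x)}
... | yes (c , gc∉x) = g c , (c , ≐-refl (g c)) , gc∉x
... | no ∄ = ⊥-elim (x≉y (≐-ext x⊆y y⊆x))
  where
  y⊆x : ∀ z → z ∈ sup C g → z ∈ x
  y⊆x z (c , z≐gc) with em {g c ∈ x}
  ... | yes gc∈x = ∈-respˡ-≐ (≐-sym z≐gc) gc∈x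
  ... | no gc∉x = ⊥-elim (∄ (c , gc∉x))

RankBelow-resp-≐ : ∀ n {x y} → x ≐ y → RankBelow n x → RankBelow n y
RankBelow-resp-≐ (suc n) {sup A f} {sup B g} (_ , q) r b =
  RankBelow-resp-≐ n (proj₂ (q b)) (r (proj₁ (q b)))

RankBelow-mono : ∀ {m n} x → m ≤ n → RankBelow m x → RankBelow n x
RankBelow-mono (sup A f) (s≤s m≤n) r a = RankBelow-mono (f a) m≤n (r a)

RankBelow-suc : ∀ n x → (∀ y → y ∈ x → RankBelow n y) → RankBelow (suc n) x
RankBelow-suc n (sup A f) members a = members (f a) (a , ≐-refl (f a))

numeral : ℕ → V
numeral zero    = ∅
numeral (suc k) = pair ∅ (numeral k)

numeral-rank : ∀ k → RankBelow (suc k) (numeral k)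
numeral-rank zero    ()
numeral-rank (suc k) true  ()
numeral-rank (suc k) false = numeral-rank k

HasNumeralsBelow : V → ℕ → Set
HasNumeralsBelow y k = ∀ j → j < k → numeral (suc j) ∈ y

HasNumeralsBelow-suc : ∀ {y k} → HasNumeralsBelow y k → numeral (suc k) ∈ y →
                       HasNumeralsBelow y (suc k)
HasNumeralsBelow-suc below top j j<1+k with m<1+n⇒m<n∨m≡n j<1+k
... | inj₁ j<k  = below j j<k
... | inj₂ refl = top

module _ {Y Z : V} (Z≐ : (⟦ ∅ ⟧ ⊗ (⟦ ∅ ⟧ ∪ Y)) ≐ Z) (Y⊆Z : Y ⊆ Z) where

  ∈Z-cases : ∀ {x} → x ∈ Z → x ≐ numeral 1 ⊎ Σ V λ y → y ∈ Y × x ≐ pair ∅ y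
  ∈Z-cases x∈Z with ∈-⊗ (∈-respʳ-≐ (≐-sym Z≐) x∈Z)
  ... | a , b , a∈⟦∅⟧ , b∈∅∪Y , x≐ab with ∈-∪ b∈∅∪Y
  ...   | inj₁ b∈⟦∅⟧ = inj₁ (≐-trans x≐ab (pair-cong (∈-⟦⟧ a∈⟦∅⟧) (∈-⟦⟧ b∈⟦∅⟧)))
  ...   | inj₂ b∈Y   = inj₂ (b , b∈Y , ≐-trans x≐ab (pair-cong (∈-⟦⟧ a∈⟦∅⟧) (≐-refl b)))

  -- The recursion is on the member h a of x = sup A h that represents y ∈ x = {∅, y}.
  ∈Z⇒numeral : ∀ x → x ∈ Z → Σ ℕ λ k → x ≐ numeral (suc k) × HasNumeralsBelow Y k
  ∈Z⇒numeral x x∈Z with ∈Z-cases x∈Z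
  ... | inj₁ x≐1 = zero , x≐1 , λ _ ()
  ∈Z⇒numeral (sup A h) _ | inj₂ (y , y∈Y , x≐∅y)
    with ∈-respʳ-≐ (≐-sym x≐∅y) (∈-pairʳ ∅ y)
  ... | a , y≐ha with ∈-respˡ-≐ y≐ha y∈Y
  ...   | ha∈Y with ∈Z⇒numeral (h a) (Y⊆Z (h a) ha∈Y)
  ...     | k , ha≐k+1 , below =
    suc k ,
    ≐-trans x≐∅y (pair-cong (≐-refl ∅) (≐-trans y≐ha ha≐k+1)) ,
    HasNumeralsBelow-suc below (∈-respˡ-≐ ha≐k+1 ha∈Y)

  module _ (m : ℕ) (top∈Z : numeral (suc m) ∈ Z) (top∉Y : ¬ (numeral (suc m) ∈ Y))
           (below : HasNumeralsBelow Y m) where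

    ∈Z⇒numeral-≤ : ∀ x → x ∈ Z → Σ ℕ λ k → k ≤ m × x ≐ numeral (suc k)
    ∈Z⇒numeral-≤ x x∈Z with ∈Z⇒numeral x x∈Z
    ... | k , x≐k+1 , belowₖ with m <? k
    ...   | yes m<k = ⊥-elim (top∉Y (belowₖ m m<k))
    ...   | no  m≮k = k , ≮⇒≥ m≮k , x≐k+1

    Z-rankFinite : RankFinite Z
    Z-rankFinite = suc (suc (suc m)) , RankBelow-suc _ Z members
      where
      members : ∀ x → x ∈ Z → RankBelow (suc (suc m)) x
      members x x∈Z with ∈Z⇒numeral-≤ x x∈Z
      ... | k , k≤m , x≐k+1 =
        RankBelow-resp-≐ _ (≐-sym x≐k+1)
          (RankBelow-mono (numeral (suc k)) (s≤s (s≤s k≤m)) (numeral-rank (suc k)))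

    Z∖Y≐top : (Z ∖ Y) ≐ ⟦ numeral (suc m) ⟧
    Z∖Y≐top = ≐-singleton members (∖-∈ top∈Z top∉Y)
      where
      members : ∀ x → x ∈ (Z ∖ Y) → x ≐ numeral (suc m)
      members x x∈Z∖Y with ∈-∖ {z = Y} x∈Z∖Y
      ... | x∈Z , x∉Y with ∈Z⇒numeral-≤ x x∈Z
      ...   | k , k≤m , x≐k+1 with m≤n⇒m<n∨m≡n k≤m
      ...     | inj₁ k<m  = ⊥-elim (x∉Y (∈-respˡ-≐ (≐-sym x≐k+1) (below k k<m)))
      ...     | inj₂ refl = x≐k+1

theorem1 : ExcludedMiddle lzero → (Y Z : V) →
    (⟦ ∅ ⟧ ⊗ (⟦ ∅ ⟧ ∪ Y)) ≐ Z → Y ⊊ Z →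
    RankFinite Z × CardOne (Z ∖ Y)
theorem1 em Y Z Z≐ Y⊊Z@(Y⊆Z , _) with ⊊-witness em Y⊊Z
... | z , z∈Z , z∉Y with ∈Z⇒numeral Z≐ Y⊆Z z z∈Z
... | m , z≐m+1 , below =
  Z-rankFinite Z≐ Y⊆Z m top∈Z top∉Y below ,
  (numeral (suc m) , Z∖Y≐top Z≐ Y⊆Z m top∈Z top∉Y below)
  where
  top∈Z : numeral (suc m) ∈ Z
  top∈Z = ∈-respˡ-≐ z≐m+1 z∈Z
  top∉Y : ¬ (numeral (suc m) ∈ Y)
  top∉Y top∈Y = z∉Y (∈-respˡ-≐ (≐-sym z≐m+1) top∈Y)
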